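{- For any tree $T$ with at least two vertices, $Z(T) \le Z(L(T))$.
   Context: All graphs are finite and simple. $L(T)$ is the line graph of $T$ (vertex set $E(T)$, two vertices adjacent iff the edges share an endpoint). Zero forcing: each vertex of a graph $H$ is colored black or white; if a black vertex $u$ has exactly one white neighbor $w$, then $w$ becomes black (color-change rule). $S \subseteq V(H)$ is a zero forcing set if, starting with exactly $S$ black, repeated application of the rule makes every vertex black. $Z(H)$ is the minimum size of a zero forcing set of $H$. -}

module Defs where

open import Data.Nat using (ℕ; _≤_; _<ᵇ_)
open import Data.Bool using (Bool; true; false; _∧_; not; if_then_else_)
open import Data.Fin using (Fin; toℕ; _≟_)
open import Data.Fin.Subset using (Subset; _∈_; _∉_; ⁅_⁆; _∪_; ∣_∣)
open import Data.List using (List; []; _∷_; _++_; [_]; length; concatMap; lookup; allFin)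
open import Data.List.Relation.Unary.Linked using (Linked)
open import Data.List.Relation.Unary.Unique.Propositional using (Unique)
open import Data.List.Relation.Unary.Any using (Any)
open import Data.Product using (Σ; _×_; _,_; proj₁; proj₂)
open import Relation.Binary.PropositionalEquality using (_≡_; _≢_)
open import Relation.Nullary using (¬_)
open import Relation.Nullary.Decidable using (⌊_⌋)

record Graph (n : ℕ) : Set where
  field
    adj : Fin n → Fin n → Bool

open Graph public

Adj : ∀ {n} → Graph n → Fin n → Fin n → Set
Adj G u v = adj G u v ≡ true

IsSimple : ∀ {n} → Graph n → Set
IsSimple G = (∀ u v → adj G u v ≡ adj G v u) × (∀ u → adj G u u ≡ false)

data Walk {n} (G : Graph n) : Fin n → Fin n → Set where
  here : ∀ {u} → Walk G u u
  step : ∀ {u v w} → Adj G u v → Walk G v w → Walk G u w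

Connected : ∀ {n} → Graph n → Set
Connected G = ∀ u v → Walk G u v

IsCycle : ∀ {n} → Graph n → Fin n → List (Fin n) → Set
IsCycle G x ys = (2 ≤ length ys) × Unique (x ∷ ys) × Linked (Adj G) (x ∷ (ys ++ [ x ]))

Acyclic : ∀ {n} → Graph n → Set
Acyclic {n} G = ∀ (x : Fin n) (ys : List (Fin n)) → ¬ IsCycle G x ys

IsTree : ∀ {n} → Graph n → Set
IsTree G = IsSimple G × Connected G × Acyclic G

edgeList : ∀ {n} → Graph n → List (Fin n × Fin n)
edgeList {n} G =
  concatMap (λ i → concatMap (λ j →
    if (toℕ i <ᵇ toℕ j) ∧ adj G i j then [ (i , j) ] else [])
    (allFin n)) (allFin n)

numEdges : ∀ {n} → Graph n → ℕ
numEdges G = length (edgeList G)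

edgeAt : ∀ {n} (G : Graph n) → Fin (numEdges G) → Fin n × Fin n
edgeAt G k = lookup (edgeList G) k

_==_ : ∀ {n} → Fin n → Fin n → Bool
i == j = ⌊ i ≟ j ⌋

shareEnd : ∀ {n} → Fin n × Fin n → Fin n × Fin n → Bool
shareEnd (a , b) (c , d) =
  Data.Bool._∨_ (Data.Bool._∨_ (a == c) (a == d)) (Data.Bool._∨_ (b == c) (b == d))
  where import Data.Bool

lineGraph : ∀ {n} (G : Graph n) → Graph (numEdges G)
lineGraph G = record { adj = λ e f → not (e == f) ∧ shareEnd (edgeAt G e) (edgeAt G f) }

data ZFReach {n} (G : Graph n) : Subset n → Set where
  allBlack : ∀ {B} → (∀ v → v ∈ B) → ZFReach G B
  force    : ∀ {B} (u w : Fin n) →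
             u ∈ B → w ∉ B → Adj G u w →
             (∀ x → Adj G u x → x ≢ w → x ∈ B) →
             ZFReach G (⁅ w ⁆ ∪ B) →
             ZFReach G B

IsZeroForcingSet : ∀ {n} → Graph n → Subset n → Set
IsZeroForcingSet G S = ZFReach G S

IsZ : ∀ {n} → Graph n → ℕ → Set
IsZ {n} G k =
  Σ (Subset n) (λ S → IsZeroForcingSet G S × ∣ S ∣ ≡ k) ×
  (∀ (S : Subset n) → IsZeroForcingSet G S → k ≤ ∣ S ∣)

module Submission where

-- For a zero forcing set X of L(G) we find a map h sending every edge of G to one of its ends
-- such that h(X) forces G; then Z(G) ≤ |h(X)| ≤ |X|. The proof runs backwards along the forcing
-- process. When all edges are black, orient every edge away from a root r by distance: each
-- vertex but r is hit, and r is forced by a neighbour. A force e → f of L(G) through the common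
-- end v, where e = uv and f = vw, is simulated in G by the forces u → v and v → w, after
-- redirecting every edge at v away from v and every other edge at u away from u.

open import Defs
open import Data.Nat using (ℕ; zero; suc; _≤_; _<_; _<ᵇ_; _+_; z≤n; s≤s)
open import Data.Nat.Properties
  using ( ≤-trans; ≤-reflexive; <⇒<ᵇ; _<?_; +-monoʳ-≤; +-suc; n≤1+n; 1+n≰n; <-asym
        ; module ≤-Reasoning)
open import Data.Bool using (true; false; _∧_; T; if_then_else_)
import Data.Bool.Properties as Bool
open import Data.Fin using (Fin; zero; suc; toℕ; _≟_)
open import Data.Fin.Properties using (<-cmp; any?)
open import Data.Fin.Subset using (Subset; _∈_; ⁅_⁆; _∪_; ∣_∣; _⊆_; ⊥)
open import Data.Fin.Subset.Properties
  using (_∈?_; x∈p∪q⁻; x∈p∪q⁺; p⊆p∪q; q⊆p∪q; x∈⁅x⁆; x∈⁅y⁆⇒x≡y; ∣⁅x⁆∣≡1; ∣⊥∣≡0; ∉⊥; ⊆-trans)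
open import Data.List using (List; []; _∷_; allFin)
open import Data.List.Membership.Propositional using () renaming (_∈_ to _∈ˡ_)
open import Data.List.Membership.Propositional.Properties
  using (∈-concatMap⁻; ∈-concatMap⁺; ∈-lookup; ∈-allFin)
open import Data.List.Relation.Unary.Any as Any using (here; satisfied)
open import Data.List.Relation.Unary.Any.Properties using (lookup-index)
open import Data.Vec using ([]; _∷_) renaming (here to vhere; there to vthere)
open import Data.Product using (∃-syntax; _×_; _,_; proj₁; proj₂; map₂)
open import Data.Sum using (_⊎_; inj₁; inj₂; [_,_])
open import Data.Empty using (⊥-elim)
open import Function using (_∘_)
open import Relation.Binary using (tri<; tri≈; tri>)
open import Relation.Binary.PropositionalEquality
  using (_≡_; _≢_; refl; sym; trans; cong; subst; module ≡-Reasoning)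
open import Relation.Nullary using (¬_; Dec; yes; no)
open import Relation.Nullary.Decidable using (_⊎-dec_; _×-dec_)
open import Relation.Unary using (Pred; Decidable)

private
  variable
    m n : ℕ

∣p∪q∣≤∣p∣+∣q∣ : (p q : Subset n) → ∣ p ∪ q ∣ ≤ ∣ p ∣ + ∣ q ∣
∣p∪q∣≤∣p∣+∣q∣ []          []          = z≤n
∣p∪q∣≤∣p∣+∣q∣ (true ∷ p)  (true ∷ q)  =
  s≤s (≤-trans (∣p∪q∣≤∣p∣+∣q∣ p q) (+-monoʳ-≤ ∣ p ∣ (n≤1+n ∣ q ∣)))
∣p∪q∣≤∣p∣+∣q∣ (true ∷ p)  (false ∷ q) = s≤s (∣p∪q∣≤∣p∣+∣q∣ p q)
∣p∪q∣≤∣p∣+∣q∣ (false ∷ p) (true ∷ q)  =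
  subst (∣ p ∪ q ∣ <_) (sym (+-suc ∣ p ∣ ∣ q ∣)) (s≤s (∣p∪q∣≤∣p∣+∣q∣ p q))
∣p∪q∣≤∣p∣+∣q∣ (false ∷ p) (false ∷ q) = ∣p∪q∣≤∣p∣+∣q∣ p q

∪-⊆ : {p q r : Subset n} → p ⊆ r → q ⊆ r → p ∪ q ⊆ r
∪-⊆ {p = p} {q} p⊆r q⊆r = [ p⊆r , q⊆r ] ∘ x∈p∪q⁻ p q

∈⇒⁅⁆⊆ : {x : Fin n} {p : Subset n} → x ∈ p → ⁅ x ⁆ ⊆ p
∈⇒⁅⁆⊆ {x = x} {p} x∈p y∈⁅x⁆ = subst (_∈ p) (sym (x∈⁅y⁆⇒x≡y x y∈⁅x⁆)) x∈p

image : (Fin m → Fin n) → Subset m → Subset n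
image h []          = ⊥
image h (true ∷ p)  = ⁅ h zero ⁆ ∪ image (h ∘ suc) p
image h (false ∷ p) = image (h ∘ suc) p

∈-image⁺ : (h : Fin m → Fin n) (p : Subset m) {x : Fin m} → x ∈ p → h x ∈ image h p
∈-image⁺ h (true ∷ p)  vhere        = x∈p∪q⁺ (inj₁ (x∈⁅x⁆ (h zero)))
∈-image⁺ h (true ∷ p)  (vthere x∈p) = x∈p∪q⁺ (inj₂ (∈-image⁺ (h ∘ suc) p x∈p))
∈-image⁺ h (false ∷ p) (vthere x∈p) = ∈-image⁺ (h ∘ suc) p x∈p

∈-image⁻ : (h : Fin m → Fin n) (p : Subset m) {y : Fin n} →
           y ∈ image h p → ∃[ x ] x ∈ p × h x ≡ y
∈-image⁻ h []          y∈ = ⊥-elim (∉⊥ y∈)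
∈-image⁻ h (true ∷ p)  y∈ with x∈p∪q⁻ ⁅ h zero ⁆ _ y∈
... | inj₁ y∈⁅h0⁆ = zero , vhere , sym (x∈⁅y⁆⇒x≡y _ y∈⁅h0⁆)
... | inj₂ y∈img  = let x , x∈p , hx≡y = ∈-image⁻ (h ∘ suc) p y∈img in suc x , vthere x∈p , hx≡y
∈-image⁻ h (false ∷ p) y∈ =
  let x , x∈p , hx≡y = ∈-image⁻ (h ∘ suc) p y∈ in suc x , vthere x∈p , hx≡y

∣image∣≤∣p∣ : (h : Fin m → Fin n) (p : Subset m) → ∣ image h p ∣ ≤ ∣ p ∣
∣image∣≤∣p∣ {n = n} h [] = ≤-reflexive (∣⊥∣≡0 n)
∣image∣≤∣p∣ h (true ∷ p) = begin
  ∣ ⁅ h zero ⁆ ∪ image (h ∘ suc) p ∣      ≤⟨ ∣p∪q∣≤∣p∣+∣q∣ ⁅ h zero ⁆ _ ⟩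
  ∣ ⁅ h zero ⁆ ∣ + ∣ image (h ∘ suc) p ∣  ≡⟨ cong (_+ ∣ image (h ∘ suc) p ∣) (∣⁅x⁆∣≡1 (h zero)) ⟩
  suc ∣ image (h ∘ suc) p ∣              ≤⟨ s≤s (∣image∣≤∣p∣ (h ∘ suc) p) ⟩
  suc ∣ p ∣                              ∎
  where open ≤-Reasoning
∣image∣≤∣p∣ h (false ∷ p) = ∣image∣≤∣p∣ (h ∘ suc) p

least : ∀ {ℓ} {P : Pred ℕ ℓ} → Decidable P → ∀ {b} → P b →
        ∃[ k ] P k × (∀ {j} → P j → k ≤ j)
least P? pb with P? zero
... | yes p0 = zero , p0 , λ _ → z≤n
least P? {zero}  pb | no ¬p0 = ⊥-elim (¬p0 pb)
least P? {suc b} pb | no ¬p0 with least (P? ∘ suc) pb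
... | k , pk , k-min = suc k , pk , λ { {zero} p0 → ⊥-elim (¬p0 p0) ; {suc j} pj → s≤s (k-min pj) }

Adj-sym : {G : Graph n} → IsSimple G → ∀ {a b} → Adj G a b → Adj G b a
Adj-sym (symmetric , _) {a} {b} a~b = trans (symmetric b a) a~b

Adj⇒≢ : {G : Graph n} → IsSimple G → ∀ {a b} → Adj G a b → a ≢ b
Adj⇒≢ (_ , loopless) {a} a~a refl with trans (sym a~a) (loopless a)
... | ()

ZFReach-mono : {G : Graph n} {p q : Subset n} → p ⊆ q → ZFReach G p → ZFReach G q
ZFReach-mono p⊆q (allBlack all) = allBlack (p⊆q ∘ all)
ZFReach-mono {q = q} p⊆q (force u w u∈p w∉p u~w others rest) with w ∈? q
... | yes w∈q = ZFReach-mono (∪-⊆ (∈⇒⁅⁆⊆ w∈q) p⊆q) rest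
... | no  w∉q = force u w (p⊆q u∈p) w∉q u~w (λ x u~x x≢w → p⊆q (others x u~x x≢w))
                  (ZFReach-mono (∪-⊆ (p⊆p∪q _) (⊆-trans p⊆q (q⊆p∪q _ q))) rest)

force′ : {G : Graph n} {p : Subset n} (u w : Fin n) → u ∈ p → Adj G u w →
         (∀ x → Adj G u x → x ≢ w → x ∈ p) → ZFReach G (⁅ w ⁆ ∪ p) → ZFReach G p
force′ {p = p} u w u∈p u~w others rest with w ∈? p
... | yes w∈p = ZFReach-mono (∪-⊆ (∈⇒⁅⁆⊆ w∈p) (λ x∈p → x∈p)) rest
... | no  w∉p = force u w u∈p w∉p u~w others rest

allButOne⇒ZFReach : {G : Graph n} → IsSimple G → {p : Subset n} {r y : Fin n} →
                    Adj G r y → (∀ v → v ≢ r → v ∈ p) → ZFReach G p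
allButOne⇒ZFReach simple {p} {r} {y} r~y covers =
  force′ y r (covers y (Adj⇒≢ simple r~y ∘ sym)) (Adj-sym simple r~y) (λ x _ x≢r → covers x x≢r)
    (allBlack cover)
  where
  cover : ∀ v → v ∈ ⁅ r ⁆ ∪ p
  cover v with v ≟ r
  ... | yes refl = x∈p∪q⁺ (inj₁ (x∈⁅x⁆ v))
  ... | no  v≢r  = x∈p∪q⁺ (inj₂ (covers v v≢r))

_∈ₚ_ : Fin n → Fin n × Fin n → Set
x ∈ₚ (a , b) = x ≡ a ⊎ x ≡ b

_∈ₚ?_ : (x : Fin n) (p : Fin n × Fin n) → Dec (x ∈ₚ p)
x ∈ₚ? (a , b) = (x ≟ a) ⊎-dec (x ≟ b)

opposite : Fin n × Fin n → Fin n → Fin n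
opposite (a , b) x with x ≟ a
... | yes _ = b
... | no  _ = a

opposite-∈ₚ : (p : Fin n × Fin n) (x : Fin n) → opposite p x ∈ₚ p
opposite-∈ₚ (a , b) x with x ≟ a
... | yes _ = inj₂ refl
... | no  _ = inj₁ refl

opposite-unique : {p : Fin n × Fin n} {x z : Fin n} → x ∈ₚ p → z ∈ₚ p → z ≢ x → z ≡ opposite p x
opposite-unique {p = a , b} {x} x∈p z∈p z≢x with x ≟ a | x∈p | z∈p
... | yes refl | _         | inj₁ refl = ⊥-elim (z≢x refl)
... | yes refl | _         | inj₂ z≡b  = z≡b
... | no  x≢a  | inj₁ x≡a  | _         = ⊥-elim (x≢a x≡a)
... | no  _    | inj₂ _    | inj₁ z≡a  = z≡a
... | no  _    | inj₂ refl | inj₂ refl = ⊥-elim (z≢x refl)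

shareEnd-sound : (p q : Fin n × Fin n) → shareEnd p q ≡ true → ∃[ x ] x ∈ₚ p × x ∈ₚ q
shareEnd-sound (a , b) (c , d) shared with a ≟ c | a ≟ d | b ≟ c | b ≟ d
... | yes a≡c | _       | _       | _       = a , inj₁ refl , inj₁ a≡c
... | no  _   | yes a≡d | _       | _       = a , inj₁ refl , inj₂ a≡d
... | no  _   | no  _   | yes b≡c | _       = b , inj₂ refl , inj₁ b≡c
... | no  _   | no  _   | no  _   | yes b≡d = b , inj₂ refl , inj₂ b≡d
shareEnd-sound (a , b) (c , d) () | no _ | no _ | no _ | no _

shareEnd-complete : (p q : Fin n × Fin n) {x : Fin n} → x ∈ₚ p → x ∈ₚ q → shareEnd p q ≡ true
shareEnd-complete (a , b) (c , d) x∈p x∈q with a ≟ c | a ≟ d | b ≟ c | b ≟ d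
... | yes _ | _     | _     | _     = refl
... | no  _ | yes _ | _     | _     = refl
... | no  _ | no  _ | yes _ | _     = refl
... | no  _ | no  _ | no  _ | yes _ = refl
... | no a≢c | no a≢d | no b≢c | no b≢d with x∈p | x∈q
...   | inj₁ refl | inj₁ refl = ⊥-elim (a≢c refl)
...   | inj₁ refl | inj₂ refl = ⊥-elim (a≢d refl)
...   | inj₂ refl | inj₁ refl = ⊥-elim (b≢c refl)
...   | inj₂ refl | inj₂ refl = ⊥-elim (b≢d refl)

edgeCell : (G : Graph n) → Fin n → Fin n → List (Fin n × Fin n)
edgeCell G i j = if (toℕ i <ᵇ toℕ j) ∧ adj G i j then (i , j) ∷ [] else []

edgeAt-adj : (G : Graph n) (e : Fin (numEdges G)) → Adj G (proj₁ (edgeAt G e)) (proj₂ (edgeAt G e))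
edgeAt-adj {n} G e = listed-adj (∈-lookup e)
  where
  cell-adj : ∀ i j {p} → p ∈ˡ edgeCell G i j → Adj G (proj₁ p) (proj₂ p)
  cell-adj i j p∈ with toℕ i <ᵇ toℕ j | adj G i j in i~j
  cell-adj i j (here refl) | true | true = i~j

  listed-adj : ∀ {p} → p ∈ˡ edgeList G → Adj G (proj₁ p) (proj₂ p)
  listed-adj p∈ with satisfied (∈-concatMap⁻ _ {xs = allFin n} p∈)
  ... | i , p∈row with satisfied (∈-concatMap⁻ _ {xs = allFin n} p∈row)
  ... | j , p∈cell = cell-adj i j p∈cell

edgeAt-complete : (G : Graph n) {a b : Fin n} → toℕ a < toℕ b → Adj G a b →
                  ∃[ e ] edgeAt G e ≡ (a , b)
edgeAt-complete {n} G {a} {b} a<b a~b = Any.index listed , sym (lookup-index listed)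
  where
  in-cell : (a , b) ∈ˡ edgeCell G a b
  in-cell rewrite a~b with toℕ a <ᵇ toℕ b in a<ᵇb
  ... | true  = here refl
  ... | false = ⊥-elim (subst T a<ᵇb (<⇒<ᵇ a<b))

  listed : (a , b) ∈ˡ edgeList G
  listed = ∈-concatMap⁺ _ {xs = allFin n} (Any.map (λ { refl →
             ∈-concatMap⁺ _ {xs = allFin n} (Any.map (λ { refl → in-cell }) (∈-allFin b)) })
             (∈-allFin a))

edgeJoining : {G : Graph n} → IsSimple G → {a b : Fin n} → Adj G a b →
              ∃[ e ] (edgeAt G e ≡ (a , b) ⊎ edgeAt G e ≡ (b , a))
edgeJoining {G = G} simple {a} {b} a~b with <-cmp a b
... | tri< a<b _ _ = map₂ inj₁ (edgeAt-complete G a<b a~b)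
... | tri≈ _ refl _ = ⊥-elim (Adj⇒≢ simple a~b refl)
... | tri> _ _ b<a = map₂ inj₂ (edgeAt-complete G b<a (Adj-sym simple a~b))

walkLength : {G : Graph n} {a b : Fin n} → Walk G a b → ℕ
walkLength here       = zero
walkLength (step _ w) = suc (walkLength w)

module Distance {G : Graph n} (simple : IsSimple G) (connected : Connected G) (r : Fin n) where

  Near : ℕ → Fin n → Set
  Near zero    x = x ≡ r
  Near (suc k) x = Near k x ⊎ ∃[ y ] Adj G x y × Near k y

  near? : ∀ k x → Dec (Near k x)
  near? zero    x = x ≟ r
  near? (suc k) x = near? k x ⊎-dec any? (λ y → (adj G x y Bool.≟ true) ×-dec near? k y)

  walk⇒Near : {x : Fin n} (w : Walk G x r) → Near (walkLength w) x
  walk⇒Near here         = refl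
  walk⇒Near (step x~y w) = inj₂ (_ , x~y , walk⇒Near w)

  nearest : ∀ x → ∃[ k ] Near k x × (∀ {j} → Near j x → k ≤ j)
  nearest x = least (λ k → near? k x) (walk⇒Near (connected x r))

  dist : Fin n → ℕ
  dist x = proj₁ (nearest x)

  dist-minimal : ∀ {k x} → Near k x → dist x ≤ k
  dist-minimal {x = x} = proj₂ (proj₂ (nearest x))

  parent : ∀ {x} → x ≢ r → ∃[ y ] Adj G x y × dist y < dist x
  parent {x} x≢r = closer (proj₂ (nearest x))
    where
    closer : ∀ {k} → Near k x × (∀ {j} → Near j x → k ≤ j) → ∃[ y ] Adj G x y × dist y < k
    closer {zero}  (x≡r , _)                  = ⊥-elim (x≢r x≡r)
    closer {suc k} (inj₁ near , k-min)        = ⊥-elim (1+n≰n (k-min near))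
    closer {suc k} (inj₂ (y , x~y , near) , _) = y , x~y , s≤s (dist-minimal near)

  farther : Fin n × Fin n → Fin n
  farther (a , b) with dist a <? dist b
  ... | yes _ = b
  ... | no  _ = a

  farther-∈ₚ : (p : Fin n × Fin n) → farther p ∈ₚ p
  farther-∈ₚ (a , b) with dist a <? dist b
  ... | yes _ = inj₂ refl
  ... | no  _ = inj₁ refl

  farther-< : {a b : Fin n} → dist a < dist b → farther (a , b) ≡ b
  farther-< {a} {b} a<b with dist a <? dist b
  ... | yes _   = refl
  ... | no  a≮b = ⊥-elim (a≮b a<b)

  farther-≮ : {a b : Fin n} → ¬ dist a < dist b → farther (a , b) ≡ a
  farther-≮ {a} {b} a≮b with dist a <? dist b
  ... | yes a<b = ⊥-elim (a≮b a<b)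
  ... | no  _   = refl

  farther-onto : ∀ {x} → x ≢ r → ∃[ e ] farther (edgeAt G e) ≡ x
  farther-onto {x} x≢r with parent x≢r
  ... | y , x~y , y<x with edgeJoining simple x~y
  ...   | e , inj₁ e≡xy = e , trans (cong farther e≡xy) (farther-≮ {x} {y} (<-asym y<x))
  ...   | e , inj₂ e≡yx = e , trans (cong farther e≡yx) (farther-< y<x)

module Endpoints {G : Graph n} (simple : IsSimple G) where

  _∈ₑ_ : Fin n → Fin (numEdges G) → Set
  x ∈ₑ e = x ∈ₚ edgeAt G e

  _∈ₑ?_ : (x : Fin n) (e : Fin (numEdges G)) → Dec (x ∈ₑ e)
  x ∈ₑ? e = x ∈ₚ? edgeAt G e

  edgeBetween : {a b : Fin n} → Adj G a b → ∃[ e ] a ∈ₑ e × b ∈ₑ e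
  edgeBetween a~b with edgeJoining simple a~b
  ... | e , inj₁ e≡ab = e , subst (λ p → _ ∈ₚ p × _ ∈ₚ p) (sym e≡ab) (inj₁ refl , inj₂ refl)
  ... | e , inj₂ e≡ba = e , subst (λ p → _ ∈ₚ p × _ ∈ₚ p) (sym e≡ba) (inj₂ refl , inj₁ refl)

  other : Fin (numEdges G) → Fin n → Fin n
  other e = opposite (edgeAt G e)

  other-∈ₑ : (e : Fin (numEdges G)) (x : Fin n) → other e x ∈ₑ e
  other-∈ₑ e = opposite-∈ₚ (edgeAt G e)

  Adj-other : {e : Fin (numEdges G)} {x : Fin n} → x ∈ₑ e → Adj G x (other e x)
  Adj-other {e} {x} x∈e with x ≟ proj₁ (edgeAt G e) | x∈e
  ... | yes refl | _         = edgeAt-adj G e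
  ... | no  x≢a  | inj₁ x≡a  = ⊥-elim (x≢a x≡a)
  ... | no  _    | inj₂ refl = Adj-sym simple (edgeAt-adj G e)

  other-≢ : {e : Fin (numEdges G)} {x : Fin n} → x ∈ₑ e → other e x ≢ x
  other-≢ x∈e = Adj⇒≢ simple (Adj-other x∈e) ∘ sym

  ∈ₑ-other : {e : Fin (numEdges G)} {x z : Fin n} → x ∈ₑ e → z ∈ₑ e → z ≡ x ⊎ z ≡ other e x
  ∈ₑ-other {x = x} {z} x∈e z∈e with z ≟ x
  ... | yes z≡x = inj₁ z≡x
  ... | no  z≢x = inj₂ (opposite-unique x∈e z∈e z≢x)

  lineAdj-sound : {e f : Fin (numEdges G)} → Adj (lineGraph G) e f → ∃[ x ] x ∈ₑ e × x ∈ₑ f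
  lineAdj-sound {e} {f} e~f with e ≟ f
  ... | no _ = shareEnd-sound (edgeAt G e) (edgeAt G f) e~f
  lineAdj-sound () | yes _

  lineAdj-complete : {e f : Fin (numEdges G)} {x : Fin n} → e ≢ f → x ∈ₑ e → x ∈ₑ f →
                     Adj (lineGraph G) e f
  lineAdj-complete {e} {f} e≢f x∈e x∈f with e ≟ f
  ... | yes e≡f = ⊥-elim (e≢f e≡f)
  ... | no  _   = shareEnd-complete (edgeAt G e) (edgeAt G f) x∈e x∈f

  ≢-endpoints-≡ : {g : Fin (numEdges G)} {a x y : Fin n} → a ∈ₑ g → x ∈ₑ g → y ∈ₑ g →
                  x ≢ a → y ≢ a → x ≡ y
  ≢-endpoints-≡ a∈g x∈g y∈g x≢a y≢a =
    trans (opposite-unique a∈g x∈g x≢a) (sym (opposite-unique a∈g y∈g y≢a))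

  IsEndpointChoice : (Fin (numEdges G) → Fin n) → Set
  IsEndpointChoice h = ∀ e → h e ∈ₑ e

  awayFrom : Fin n → (Fin (numEdges G) → Fin n) → Fin (numEdges G) → Fin n
  awayFrom x h e with x ∈ₑ? e
  ... | yes _ = other e x
  ... | no  _ = h e

  module _ (x : Fin n) {h : Fin (numEdges G) → Fin n} where

    awayFrom-choice : IsEndpointChoice h → IsEndpointChoice (awayFrom x h)
    awayFrom-choice h-choice e with x ∈ₑ? e
    ... | yes _ = other-∈ₑ e x
    ... | no  _ = h-choice e

    awayFrom-at : ∀ {e} → x ∈ₑ e → awayFrom x h e ≡ other e x
    awayFrom-at {e} x∈e with x ∈ₑ? e
    ... | yes _   = refl
    ... | no  x∉e = ⊥-elim (x∉e x∈e)

    awayFrom-off : ∀ {e} → ¬ x ∈ₑ e → awayFrom x h e ≡ h e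
    awayFrom-off {e} x∉e with x ∈ₑ? e
    ... | yes x∈e = ⊥-elim (x∉e x∈e)
    ... | no  _   = refl

    awayFrom-cases : IsEndpointChoice h → ∀ e → h e ≡ x ⊎ h e ≡ awayFrom x h e
    awayFrom-cases h-choice e with x ∈ₑ? e
    ... | yes x∈e = ∈ₑ-other x∈e (h-choice e)
    ... | no  _   = inj₂ refl

  module ForcingStep {X : Subset (numEdges G)} {e f : Fin (numEdges G)} (e∈X : e ∈ X)
                     (others : ∀ g → Adj (lineGraph G) e g → g ≢ f → g ∈ X)
                     {v : Fin n} (v∈e : v ∈ₑ e) (v∈f : v ∈ₑ f)
                     {h : Fin (numEdges G) → Fin n} (h-choice : IsEndpointChoice h) where

    u w : Fin n
    u = other e v
    w = other f v

    h′ : Fin (numEdges G) → Fin n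
    h′ = awayFrom v (awayFrom u h)

    h′-choice : IsEndpointChoice h′
    h′-choice = awayFrom-choice v (awayFrom-choice u h-choice)

    Y : Subset n
    Y = image h′ X

    ∈Y : ∀ {g x} → g ∈ X → h′ g ≡ x → x ∈ Y
    ∈Y {g} g∈X h′g≡x = subst (_∈ Y) h′g≡x (∈-image⁺ h′ X g∈X)

    meets-e⇒∈X : ∀ {g x} → g ≢ f → x ∈ₑ e → x ∈ₑ g → g ∈ X
    meets-e⇒∈X {g} g≢f x∈e x∈g with e ≟ g
    ... | yes refl = e∈X
    ... | no  e≢g  = others g (lineAdj-complete e≢g x∈e x∈g) g≢f

    u≢v : u ≢ v
    u≢v = other-≢ v∈e

    u∈Y : u ∈ Y
    u∈Y = ∈Y e∈X (awayFrom-at v v∈e)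

    u-forces-v : ∀ x → Adj G u x → x ≢ v → x ∈ Y
    u-forces-v x u~x x≢v with edgeBetween u~x
    ... | g , u∈g , x∈g = ∈Y (meets-e⇒∈X g≢f (other-∈ₑ e v) u∈g) h′g≡x
      where
      x≢u : x ≢ u
      x≢u = Adj⇒≢ simple u~x ∘ sym

      g≢f : g ≢ f
      g≢f refl = x≢u (≢-endpoints-≡ v∈f x∈g u∈g x≢v u≢v)

      v∉g : ¬ v ∈ₑ g
      v∉g v∈g = x≢v (≢-endpoints-≡ u∈g x∈g v∈g x≢u (u≢v ∘ sym))

      h′g≡x : h′ g ≡ x
      h′g≡x = begin
        h′ g                 ≡⟨ awayFrom-off v v∉g ⟩
        awayFrom u h g       ≡⟨ awayFrom-at u u∈g ⟩
        other g u            ≡⟨ opposite-unique u∈g x∈g x≢u ⟨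
        x                    ∎
        where open ≡-Reasoning

    v-forces-w : ∀ x → Adj G v x → x ≢ w → x ∈ ⁅ v ⁆ ∪ Y
    v-forces-w x v~x x≢w with edgeBetween v~x
    ... | g , v∈g , x∈g = x∈p∪q⁺ (inj₂ (∈Y (meets-e⇒∈X g≢f v∈e v∈g) h′g≡x))
      where
      x≢v : x ≢ v
      x≢v = Adj⇒≢ simple v~x ∘ sym

      g≢f : g ≢ f
      g≢f refl = x≢w (opposite-unique v∈f x∈g x≢v)

      h′g≡x : h′ g ≡ x
      h′g≡x = trans (awayFrom-at v v∈g) (sym (opposite-unique v∈g x∈g x≢v))

    h-cases : ∀ g → h g ≡ u ⊎ h g ≡ v ⊎ h g ≡ h′ g
    h-cases g with awayFrom-cases u h-choice g
    ... | inj₁ hg≡u = inj₁ hg≡u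
    ... | inj₂ hg≡h₁g with awayFrom-cases v (awayFrom-choice u h-choice) g
    ...   | inj₁ h₁g≡v  = inj₂ (inj₁ (trans hg≡h₁g h₁g≡v))
    ...   | inj₂ h₁g≡h′g = inj₂ (inj₂ (trans hg≡h₁g h₁g≡h′g))

    B : Subset n
    B = ⁅ w ⁆ ∪ (⁅ v ⁆ ∪ Y)

    ≡v⇒∈B : ∀ {z} → z ≡ v → z ∈ B
    ≡v⇒∈B refl = x∈p∪q⁺ (inj₂ (x∈p∪q⁺ (inj₁ (x∈⁅x⁆ v))))

    ≡w⇒∈B : ∀ {z} → z ≡ w → z ∈ B
    ≡w⇒∈B refl = x∈p∪q⁺ (inj₁ (x∈⁅x⁆ w))

    ≡∈Y⇒∈B : ∀ {z y} → z ≡ y → y ∈ Y → z ∈ B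
    ≡∈Y⇒∈B refl y∈Y = x∈p∪q⁺ (inj₂ (x∈p∪q⁺ (inj₂ y∈Y)))

    covered : image h (⁅ f ⁆ ∪ X) ⊆ B
    covered z∈ with ∈-image⁻ h (⁅ f ⁆ ∪ X) z∈
    ... | g , g∈ , refl with x∈p∪q⁻ ⁅ f ⁆ X g∈
    ...   | inj₁ g∈⁅f⁆ rewrite x∈⁅y⁆⇒x≡y f g∈⁅f⁆ = [ ≡v⇒∈B , ≡w⇒∈B ] (∈ₑ-other v∈f (h-choice f))
    ...   | inj₂ g∈X =
      [ (λ hg≡u → ≡∈Y⇒∈B hg≡u u∈Y) ,
        [ ≡v⇒∈B , (λ hg≡h′g → ≡∈Y⇒∈B hg≡h′g (∈Y g∈X refl)) ] ] (h-cases g)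

    zf-step : ZFReach G (image h (⁅ f ⁆ ∪ X)) → ZFReach G Y
    zf-step zf = force′ u v u∈Y (Adj-sym simple (Adj-other v∈e)) u-forces-v
                   (force′ v w (x∈p∪q⁺ (inj₁ (x∈⁅x⁆ v))) (Adj-other v∈f) v-forces-w
                     (ZFReach-mono covered zf))

  lineForcing⇒forcing : {h₀ : Fin (numEdges G) → Fin n} → IsEndpointChoice h₀ →
                        (∀ {X} → (∀ g → g ∈ X) → ZFReach G (image h₀ X)) →
                        ∀ {X} → ZFReach (lineGraph G) X →
                        ∃[ h ] IsEndpointChoice h × ZFReach G (image h X)
  lineForcing⇒forcing h₀-choice base (allBlack all) = _ , h₀-choice , base all
  lineForcing⇒forcing h₀-choice base (force e f e∈X _ e~f others rest)
    with lineForcing⇒forcing h₀-choice base rest | lineAdj-sound e~f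
  ... | h , h-choice , zf | v , v∈e , v∈f = h′ , h′-choice , zf-step zf
    where open ForcingStep e∈X others v∈e v∈f h-choice

forcingSet-≤-lineForcingSet : {G : Graph n} → IsSimple G → Connected G → {r y : Fin n} → Adj G r y →
                              {X : Subset (numEdges G)} → ZFReach (lineGraph G) X →
                              ∃[ S ] ZFReach G S × ∣ S ∣ ≤ ∣ X ∣
forcingSet-≤-lineForcingSet {G = G} simple connected {r} r~y {X} X-forces =
  let h , _ , zf = lineForcing⇒forcing (farther-∈ₚ ∘ edgeAt G) allEdges-forcing X-forces
  in image h X , zf , ∣image∣≤∣p∣ h X
  where
  open Distance simple connected r
  open Endpoints simple

  allEdges-forcing : ∀ {X} → (∀ g → g ∈ X) → ZFReach G (image (farther ∘ edgeAt G) X)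
  allEdges-forcing {X} all = allButOne⇒ZFReach simple r~y λ v v≢r →
    let e , e↦v = farther-onto v≢r in subst (_∈ _) e↦v (∈-image⁺ (farther ∘ edgeAt G) X (all e))

theorem3p13 : ∀ (n : ℕ) (T : Graph n) → 2 ≤ n → IsTree T →
    ∀ (a b : ℕ) → IsZ T a → IsZ (lineGraph T) b → a ≤ b
theorem3p13 (suc (suc _)) _ (s≤s (s≤s _)) (simple , connected , _) a b
            (_ , a-minimal) ((S , S-forces , ∣S∣≡b) , _) with connected zero (suc zero)
... | step 0~y _ =
  let S′ , S′-forces , ∣S′∣≤∣S∣ = forcingSet-≤-lineForcingSet simple connected 0~y S-forces
  in subst (a ≤_) ∣S∣≡b (≤-trans (a-minimal S′ S′-forces) ∣S′∣≤∣S∣)
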